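{- Let $(F,R)$ be a rooted graph and let $T\subseteq V(F)\setminus R$ be a set of vertices such that $N[u]=N[v]$ for all $u,v\in T$. Then for any set $S\subseteq V(F)\setminus R$, either $d(S\setminus T)\le d(S)$ or $d(S\cup T)\le d(S)$.
   Context: A rooted graph $(F,R)$ is a graph $F$ with a set $R\subseteq V(F)$ of roots. For nonempty $S\subseteq V(F)\setminus R$, the rooted density is $d(S)=e(S)/|S|$, where $e(S)$ is the number of edges of $F$ with at least one endpoint in $S$. $N[v]$ denotes the closed neighbourhood of $v$ (i.e. $v$ together with its neighbours). -}

module Defs where

open import Data.Nat using (ℕ; NonZero; _<ᵇ_)
open import Data.Bool using (Bool; true; false; _∧_; _∨_; if_then_else_)
open import Data.Fin using (Fin; toℕ; _≟_)
open import Data.Fin.Subset using (Subset; ∣_∣)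
open import Data.List using (List; map; allFin)
open import Data.Nat.ListAction using (sum)
open import Data.Vec using (lookup; tabulate)
open import Data.Integer using (+_)
open import Data.Rational using (ℚ; _/_)
open import Relation.Binary.PropositionalEquality using (_≡_)
open import Relation.Nullary.Decidable using (⌊_⌋)

record Graph (n : ℕ) : Set where
  field
    adj   : Fin n → Fin n → Bool
    sym   : ∀ u v → adj u v ≡ adj v u
    irref : ∀ v → adj v v ≡ false
open Graph public

N[_]of_ : ∀ {n} → Fin n → Graph n → Subset n
N[ v ]of G = tabulate (λ w → ⌊ v ≟ w ⌋ ∨ adj G v w)

edgesTouching : ∀ {n} → Graph n → Subset n → ℕ
edgesTouching {n} G S =
  sum (map (λ i → sum (map (λ j →
    if (toℕ i <ᵇ toℕ j) ∧ adj G i j ∧ (lookup S i ∨ lookup S j) then 1 else 0)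
    (allFin n))) (allFin n))

density : ∀ {n} → Graph n → (S : Subset n) → NonZero ∣ S ∣ → ℚ
density G S nz = (+ edgesTouching G S) / ∣ S ∣
  where instance _ = nz

-- The twins of T all have the same number μ = |N[v] ─ S| of closed neighbours outside S.
-- Every vertex of S ∩ T has μ edges leaving S, all of which are lost when T is removed, so
-- e(S ─ T) + |S ∩ T| μ ≤ e(S); every vertex of T ─ S brings at most μ new edges, so
-- e(S ∪ T) ≤ e(S) + |T ─ S| μ.  If μ |S| ≤ e(S) the second bound gives d(S ∪ T) ≤ d(S);
-- otherwise the first gives d(S ─ T) ≤ d(S), and also forces S ─ T ≠ ∅.
module Submission where

open import Defs hiding (sym)
open import Data.Fin using (Fin)
open import Data.Fin.Subset using (Subset; _∈_; _⊆_; ∁; _∪_; _─_; ∣_∣)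
open import Data.Fin.Subset.Properties using (nonempty?)
open import Data.Nat using (ℕ; suc; NonZero)
import Data.Nat as ℕ
open import Data.Product using (Σ; ∃-syntax; _,_; proj₁; proj₂; map₂)
open import Data.Sum using (_⊎_; inj₁; inj₂)
import Data.Sum as Sum
open import Relation.Binary.PropositionalEquality using (_≡_; cong; subst₂)
open import Relation.Nullary using (yes; no; contradiction)

module Counting where

  open import Data.Bool using (Bool; true; false; _∧_; _∨_; not; T; if_then_else_)
  open import Data.Bool.Properties using (T-∧; T-≡; ∧-zeroʳ; ∧-identityʳ; ¬-not; ∨-comm)
  open import Data.Fin using (toℕ; _≟_) renaming (zero to fzero; suc to fsuc)
  open import Data.Fin.Properties using (<-cmp)
  open import Data.Fin.Subset using (_∩_; inside; outside)
  open import Data.Fin.Subset.Properties using (p∩q⊆q; p─q⊆p)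
  open import Data.List using (map; tabulate; allFin)
  open import Data.Nat using (zero; _+_; _*_; _≤_; _<_; z≤n; _≤ᵇ_; _<ᵇ_; _≤?_; ≢-nonZero)
  open import Data.Nat.ListAction using (sum)
  open import Data.Nat.Properties
    using ( +-*-semiring; +-commutativeSemigroup; module ≤-Reasoning; ≤ᵇ⇒≤; <⇒<ᵇ; <ᵇ⇒<
          ; +-identityʳ; +-suc; *-identityˡ; *-comm; *-assoc; *-distribˡ-+; *-distribʳ-+
          ; +-mono-≤; +-monoʳ-≤; *-monoˡ-≤; *-monoʳ-≤; +-cancelʳ-≤; *-cancelˡ-≤; <⇒≤; m≤n+m
          ; <-irrefl; ≰⇒>)
  open import Data.Vec using (_∷_; []; lookup)
  open import Data.Vec.Properties using (lookup-zipWith; lookup⇒[]=; lookup∘tabulate)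
  open import Function using (_∘_)
  open import Function.Bundles using (Equivalence)
  open import Relation.Binary.Definitions using (tri<; tri≈; tri>)
  open import Relation.Binary.PropositionalEquality
    using (_≢_; refl; sym; trans; cong₂; subst; module ≡-Reasoning)
  open import Relation.Nullary using (¬_)
  open import Relation.Nullary.Decidable using (⌊_⌋)
  open import Algebra.Properties.CommutativeSemigroup +-commutativeSemigroup using (interchange)
  open import Algebra.Properties.Semiring.Sum +-*-semiring
    using (sum-syntax; ∑-distrib-+; ∑-comm; *-distribʳ-sum; sum-cong-≗; sum-replicate-zero)

  [_] : Bool → ℕ
  [ b ] = if b then 1 else 0

  BoolFun : ℕ → Set
  BoolFun zero    = Bool
  BoolFun (suc k) = Bool → BoolFun k

  tautology? : ∀ k → BoolFun k → Bool
  tautology? zero    b = b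
  tautology? (suc k) p = tautology? k (p false) ∧ tautology? k (p true)

  -- Concluding with _≡ true rather than T lets Agda infer the predicate by unification,
  -- since T is not injective.
  Holds : ∀ k → BoolFun k → Set
  Holds zero    b = b ≡ true
  Holds (suc k) p = ∀ b → Holds k (p b)

  tautology : ∀ k (p : BoolFun k) → T (tautology? k p) → Holds k p
  tautology zero    p h       = Equivalence.to T-≡ h
  tautology (suc k) p h false = tautology k (p false) (proj₁ (Equivalence.to T-∧ h))
  tautology (suc k) p h true  = tautology k (p true)  (proj₂ (Equivalence.to T-∧ h))

  ≤ᵇ≡true⇒≤ : ∀ {m n} → (m ≤ᵇ n) ≡ true → m ≤ n
  ≤ᵇ≡true⇒≤ {m} {n} h = ≤ᵇ⇒≤ m n (Equivalence.from T-≡ h)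

  sum-map-tabulate : ∀ {n} {A : Set} (f : A → ℕ) (g : Fin n → A) →
                     sum (map f (tabulate g)) ≡ ∑[ i < n ] f (g i)
  sum-map-tabulate {zero}  f g = refl
  sum-map-tabulate {suc n} f g = cong (f (g fzero) +_) (sum-map-tabulate f (λ i → g (fsuc i)))

  sum-map-allFin : ∀ {n} (f : Fin n → ℕ) → sum (map f (allFin n)) ≡ ∑[ i < n ] f i
  sum-map-allFin f = sum-map-tabulate f (λ i → i)

  ∑-mono-≤ : ∀ {n} {f g : Fin n → ℕ} → (∀ i → f i ≤ g i) → ∑[ i < n ] f i ≤ ∑[ i < n ] g i
  ∑-mono-≤ {zero}  f≤g = z≤n
  ∑-mono-≤ {suc n} f≤g = +-mono-≤ (f≤g fzero) (∑-mono-≤ (λ i → f≤g (fsuc i)))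

  ∑∑-distrib-+ : ∀ {n} (f g : Fin n → Fin n → ℕ) →
    ∑[ i < n ] ∑[ j < n ] (f i j + g i j) ≡ ∑[ i < n ] ∑[ j < n ] f i j + ∑[ i < n ] ∑[ j < n ] g i j
  ∑∑-distrib-+ {n} f g = trans (sum-cong-≗ (λ i → ∑-distrib-+ (f i) (g i)))
    (∑-distrib-+ (λ i → ∑[ j < n ] f i j) (λ i → ∑[ j < n ] g i j))

  <ᵇ-true : ∀ {m n} → m < n → (m <ᵇ n) ≡ true
  <ᵇ-true m<n = Equivalence.to T-≡ (<⇒<ᵇ m<n)

  <ᵇ-false : ∀ {m n} → ¬ m < n → (m <ᵇ n) ≡ false
  <ᵇ-false {m} {n} m≮n = ¬-not (λ m<ᵇn → m≮n (<ᵇ⇒< m n (Equivalence.from T-≡ m<ᵇn)))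

  ∑∑-symmetric : ∀ {n} (f : Fin n → Fin n → Bool) →
    (∀ i j → f i j ≡ f j i) → (∀ i → f i i ≡ false) →
    ∑[ i < n ] ∑[ j < n ] [ f i j ]
      ≡ ∑[ i < n ] ∑[ j < n ] [ (toℕ i <ᵇ toℕ j) ∧ f i j ] + ∑[ i < n ] ∑[ j < n ] [ (toℕ i <ᵇ toℕ j) ∧ f i j ]
  ∑∑-symmetric {n} f f-sym f-irrefl = begin
    ∑[ i < n ] ∑[ j < n ] [ f i j ]                    ≡⟨ sum-cong-≗ (λ i → sum-cong-≗ (split i)) ⟩
    ∑[ i < n ] ∑[ j < n ] (below i j + below j i)   ≡⟨ ∑∑-distrib-+ below (λ i j → below j i) ⟩
    ∑∑ below + ∑[ i < n ] ∑[ j < n ] below j i     ≡⟨ cong (∑∑ below +_) (∑-comm (λ j i → below j i)) ⟨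
    ∑∑ below + ∑∑ below                               ∎
    where
    open ≡-Reasoning
    below : Fin n → Fin n → ℕ
    below i j = [ (toℕ i <ᵇ toℕ j) ∧ f i j ]
    ∑∑ : (Fin n → Fin n → ℕ) → ℕ
    ∑∑ g = ∑[ i < n ] ∑[ j < n ] g i j
    split : ∀ i j → [ f i j ] ≡ below i j + below j i
    split i j with <-cmp i j
    ... | tri< i<j _ j≮i rewrite <ᵇ-true i<j | <ᵇ-false j≮i = sym (+-identityʳ _)
    ... | tri> i≮j _ j<i rewrite <ᵇ-false i≮j | <ᵇ-true j<i = cong [_] (f-sym i j)
    ... | tri≈ _ refl _ rewrite f-irrefl i | ∧-zeroʳ (toℕ i <ᵇ toℕ i) = refl

  ∣p∣≡∑[p] : ∀ {n} (p : Subset n) → ∣ p ∣ ≡ ∑[ i < n ] [ lookup p i ]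
  ∣p∣≡∑[p] []            = refl
  ∣p∣≡∑[p] (inside  ∷ p) = cong suc (∣p∣≡∑[p] p)
  ∣p∣≡∑[p] (outside ∷ p) = ∣p∣≡∑[p] p

  ∣p∣≡∣p─q∣+∣p∩q∣ : ∀ {n} (p q : Subset n) → ∣ p ∣ ≡ ∣ p ─ q ∣ + ∣ p ∩ q ∣
  ∣p∣≡∣p─q∣+∣p∩q∣ [] []            = refl
  ∣p∣≡∣p─q∣+∣p∩q∣ (inside  ∷ p) (inside  ∷ q) = trans (cong suc (∣p∣≡∣p─q∣+∣p∩q∣ p q)) (sym (+-suc _ _))
  ∣p∣≡∣p─q∣+∣p∩q∣ (inside  ∷ p) (outside ∷ q) = cong suc (∣p∣≡∣p─q∣+∣p∩q∣ p q)
  ∣p∣≡∣p─q∣+∣p∩q∣ (outside ∷ p) (inside  ∷ q) = ∣p∣≡∣p─q∣+∣p∩q∣ p q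
  ∣p∣≡∣p─q∣+∣p∩q∣ (outside ∷ p) (outside ∷ q) = ∣p∣≡∣p─q∣+∣p∩q∣ p q

  ∣p∪q∣≡∣p∣+∣q─p∣ : ∀ {n} (p q : Subset n) → ∣ p ∪ q ∣ ≡ ∣ p ∣ + ∣ q ─ p ∣
  ∣p∪q∣≡∣p∣+∣q─p∣ [] []            = refl
  ∣p∪q∣≡∣p∣+∣q─p∣ (inside  ∷ p) (_       ∷ q) = cong suc (∣p∪q∣≡∣p∣+∣q─p∣ p q)
  ∣p∪q∣≡∣p∣+∣q─p∣ (outside ∷ p) (inside  ∷ q) = trans (cong suc (∣p∪q∣≡∣p∣+∣q─p∣ p q)) (sym (+-suc _ _))
  ∣p∪q∣≡∣p∣+∣q─p∣ (outside ∷ p) (outside ∷ q) = ∣p∪q∣≡∣p∣+∣q─p∣ p q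

  lookup─ : ∀ {n} (p q : Subset n) i → lookup (p ─ q) i ≡ lookup p i ∧ not (lookup q i)
  lookup─ (x ∷ p) (inside  ∷ q) fzero    = sym (∧-zeroʳ x)
  lookup─ (x ∷ p) (outside ∷ q) fzero    = sym (∧-identityʳ x)
  lookup─ (x ∷ p) (_       ∷ q) (fsuc i) = lookup─ p q i

  lookup∩ : ∀ {n} (p q : Subset n) i → lookup (p ∩ q) i ≡ lookup p i ∧ lookup q i
  lookup∩ p q i = lookup-zipWith _∧_ i p q

  lookup∪ : ∀ {n} (p q : Subset n) i → lookup (p ∪ q) i ≡ lookup p i ∨ lookup q i
  lookup∪ p q i = lookup-zipWith _∨_ i p q

  ∑∑-restricted : ∀ {n} (c : Subset n) (x : Fin n → Subset n) {μ} → (∀ i → i ∈ c → ∣ x i ∣ ≡ μ) →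
    ∑[ i < n ] ∑[ j < n ] [ lookup c i ∧ lookup (x i) j ] ≡ ∣ c ∣ * μ
  ∑∑-restricted {n} c x {μ} ∣x∣≡μ = begin
    ∑[ i < n ] ∑[ j < n ] [ lookup c i ∧ lookup (x i) j ]  ≡⟨ sum-cong-≗ row ⟩
    ∑[ i < n ] ([ lookup c i ] * μ)                        ≡⟨ *-distribʳ-sum μ (λ i → [ lookup c i ]) ⟨
    (∑[ i < n ] [ lookup c i ]) * μ                        ≡⟨ cong (_* μ) (∣p∣≡∑[p] c) ⟨
    ∣ c ∣ * μ                                              ∎
    where
    open ≡-Reasoning
    row : ∀ i → ∑[ j < n ] [ lookup c i ∧ lookup (x i) j ] ≡ [ lookup c i ] * μ
    row i with lookup c i in i∈c
    ... | true  = trans (sym (∣p∣≡∑[p] (x i))) (trans (∣x∣≡μ i (lookup⇒[]= i c i∈c)) (sym (*-identityˡ μ)))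
    ... | false = sum-replicate-zero n

  halve-≤ : ∀ {m n} → m + m ≤ n + n → m ≤ n
  halve-≤ {m} {n} = *-cancelˡ-≤ 2 ∘ subst₂ _≤_ (double m) (double n)
    where
    double : ∀ k → k + k ≡ 2 * k
    double k = cong (k +_) (sym (+-identityʳ k))

  extend-average-≤ : ∀ {e e′ s y μ} → e′ ≤ e + y * μ → μ * s ≤ e → e′ * s ≤ e * (s + y)
  extend-average-≤ {e} {e′} {s} {y} {μ} e′≤e+yμ μs≤e = begin
    e′ * s                ≤⟨ *-monoˡ-≤ s e′≤e+yμ ⟩
    (e + y * μ) * s       ≡⟨ *-distribʳ-+ s e (y * μ) ⟩
    e * s + y * μ * s     ≡⟨ cong (e * s +_) (*-assoc y μ s) ⟩
    e * s + y * (μ * s)   ≤⟨ +-monoʳ-≤ (e * s) (*-monoʳ-≤ y μs≤e) ⟩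
    e * s + y * e         ≡⟨ cong (e * s +_) (*-comm y e) ⟩
    e * s + e * y         ≡⟨ *-distribˡ-+ e s y ⟨
    e * (s + y)           ∎
    where open ≤-Reasoning

  shrink-average-≤ : ∀ {e e′ s x μ} → e′ + x * μ ≤ e → e < μ * (s + x) → e′ * (s + x) ≤ e * s
  shrink-average-≤ {e} {e′} {s} {x} {μ} e′+xμ≤e e<μ[s+x] = +-cancelʳ-≤ (x * (μ * (s + x))) _ _ (begin
    e′ * (s + x) + x * (μ * (s + x))  ≡⟨ cong (e′ * (s + x) +_) (*-assoc x μ (s + x)) ⟨
    e′ * (s + x) + x * μ * (s + x)    ≡⟨ *-distribʳ-+ (s + x) e′ (x * μ) ⟨
    (e′ + x * μ) * (s + x)            ≤⟨ *-monoˡ-≤ (s + x) e′+xμ≤e ⟩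
    e * (s + x)                       ≡⟨ *-distribˡ-+ e s x ⟩
    e * s + e * x                     ≤⟨ +-monoʳ-≤ (e * s) (*-monoˡ-≤ x (<⇒≤ e<μ[s+x])) ⟩
    e * s + μ * (s + x) * x           ≡⟨ cong (e * s +_) (*-comm (μ * (s + x)) x) ⟩
    e * s + x * (μ * (s + x))         ∎)
    where open ≤-Reasoning

  shrink-average-nonempty : ∀ {e e′ s x μ} → e′ + x * μ ≤ e → e < μ * (s + x) → NonZero s
  shrink-average-nonempty {e} {e′} {s} {x} {μ} e′+xμ≤e e<μ[s+x] = ≢-nonZero λ { refl →
    <-irrefl refl (begin-strict
      μ * x       ≡⟨ *-comm μ x ⟩
      x * μ       ≤⟨ m≤n+m (x * μ) e′ ⟩
      e′ + x * μ  ≤⟨ e′+xμ≤e ⟩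
      e           <⟨ e<μ[s+x] ⟩
      μ * x       ∎) }
    where open ≤-Reasoning

  -- The shapes of touches-─-bound and touches-∪-bound once the lookups are unfolded:
  -- a = adj G i j for i ≢ j, and sᵢ, tᵢ record whether i ∈ S and i ∈ T.
  restrict-pair : ∀ a si sj ti tj →
    ([ a ∧ (si ∧ not ti ∨ sj ∧ not tj) ] + ([ (si ∧ ti) ∧ a ∧ not sj ] + [ (sj ∧ tj) ∧ a ∧ not si ])
      ≤ᵇ [ a ∧ (si ∨ sj) ]) ≡ true
  restrict-pair = tautology 5 _ _

  restrict-diagonal : ∀ s t → ([ (s ∧ t) ∧ not s ] + [ (s ∧ t) ∧ not s ] ≤ᵇ 0) ≡ true
  restrict-diagonal = tautology 2 _ _

  extend-pair : ∀ a si sj ti tj →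
    ([ a ∧ ((si ∨ ti) ∨ (sj ∨ tj)) ]
      ≤ᵇ [ a ∧ (si ∨ sj) ] + ([ (ti ∧ not si) ∧ a ∧ not sj ] + [ (tj ∧ not sj) ∧ a ∧ not si ])) ≡ true
  extend-pair = tautology 5 _ _

  module EdgeCounts {n} (G : Graph n) where

    touches : Subset n → Fin n → Fin n → ℕ
    touches S i j = [ adj G i j ∧ (lookup S i ∨ lookup S j) ]

    -- Summing over ordered pairs avoids the i < j bookkeeping of edgesTouching.
    arcsTouching : Subset n → ℕ
    arcsTouching S = ∑[ i < n ] ∑[ j < n ] touches S i j

    arcsTouching≡2×edgesTouching : ∀ S → arcsTouching S ≡ edgesTouching G S + edgesTouching G S
    arcsTouching≡2×edgesTouching S =
      trans (∑∑-symmetric (λ i j → adj G i j ∧ (lookup S i ∨ lookup S j)) touching-sym touching-irrefl)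
            (cong₂ _+_ (sym edges≡∑∑) (sym edges≡∑∑))
      where
      touching-sym : ∀ i j → adj G i j ∧ (lookup S i ∨ lookup S j) ≡ adj G j i ∧ (lookup S j ∨ lookup S i)
      touching-sym i j = cong₂ _∧_ (Graph.sym G i j) (∨-comm (lookup S i) (lookup S j))
      touching-irrefl : ∀ i → adj G i i ∧ (lookup S i ∨ lookup S i) ≡ false
      touching-irrefl i = cong (_∧ _) (irref G i)
      edges≡∑∑ : edgesTouching G S
        ≡ ∑[ i < n ] ∑[ j < n ] [ (toℕ i <ᵇ toℕ j) ∧ adj G i j ∧ (lookup S i ∨ lookup S j) ]
      edges≡∑∑ = trans (sum-map-allFin {n} _) (sum-cong-≗ {n} (λ i → sum-map-allFin {n} _))

    N[i]-self : ∀ i → lookup (N[ i ]of G) i ≡ true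
    N[i]-self i rewrite lookup∘tabulate (λ w → ⌊ i ≟ w ⌋ ∨ adj G i w) i with i ≟ i
    ... | yes _   = refl
    ... | no i≢i = contradiction refl i≢i

    N[i]-≢ : ∀ {i j} → i ≢ j → lookup (N[ i ]of G) j ≡ adj G i j
    N[i]-≢ {i} {j} i≢j rewrite lookup∘tabulate (λ w → ⌊ i ≟ w ⌋ ∨ adj G i w) j with i ≟ j
    ... | yes i≡j = contradiction i≡j i≢j
    ... | no _    = refl

    module _ (S T : Subset n) where

      outgoing : Subset n → Fin n → Fin n → ℕ
      outgoing c i j = [ lookup c i ∧ lookup (N[ i ]of G ─ S) j ]

      -- An edge from a vertex of S ∩ T to a vertex outside S touches S but not S ─ T.
      touches-─-bound : ∀ i j →
        touches (S ─ T) i j + (outgoing (S ∩ T) i j + outgoing (S ∩ T) j i) ≤ touches S i j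
      touches-─-bound i j
        rewrite lookup─ S T i | lookup─ S T j | lookup∩ S T i | lookup∩ S T j
              | lookup─ (N[ i ]of G) S j | lookup─ (N[ j ]of G) S i
        with i ≟ j
      ... | yes refl rewrite N[i]-self i | irref G i =
        ≤ᵇ≡true⇒≤ (restrict-diagonal (lookup S i) (lookup T i))
      ... | no i≢j rewrite N[i]-≢ i≢j | N[i]-≢ (i≢j ∘ sym) | Graph.sym G j i =
        ≤ᵇ≡true⇒≤ (restrict-pair (adj G i j) (lookup S i) (lookup S j) (lookup T i) (lookup T j))

      -- An edge touching S ∪ T but not S joins a vertex of T ─ S to a vertex outside S.
      touches-∪-bound : ∀ i j →
        touches (S ∪ T) i j ≤ touches S i j + (outgoing (T ─ S) i j + outgoing (T ─ S) j i)
      touches-∪-bound i j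
        rewrite lookup∪ S T i | lookup∪ S T j | lookup─ T S i | lookup─ T S j
              | lookup─ (N[ i ]of G) S j | lookup─ (N[ j ]of G) S i
        with i ≟ j
      ... | yes refl rewrite irref G i = z≤n
      ... | no i≢j rewrite N[i]-≢ i≢j | N[i]-≢ (i≢j ∘ sym) | Graph.sym G j i =
        ≤ᵇ≡true⇒≤ (extend-pair (adj G i j) (lookup S i) (lookup S j) (lookup T i) (lookup T j))

      module _ {μ} (∣N[i]─S∣≡μ : ∀ i → i ∈ T → ∣ N[ i ]of G ─ S ∣ ≡ μ) where

        ∑∑-outgoing-symmetrised : ∀ c → c ⊆ T →
          ∑[ i < n ] ∑[ j < n ] (outgoing c i j + outgoing c j i) ≡ ∣ c ∣ * μ + ∣ c ∣ * μ
        ∑∑-outgoing-symmetrised c c⊆T =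
          trans (∑∑-distrib-+ (outgoing c) (λ i j → outgoing c j i))
                (cong₂ _+_ outgoing≡ (trans (∑-comm (λ i j → outgoing c j i)) outgoing≡))
          where
          outgoing≡ : ∑[ i < n ] ∑[ j < n ] outgoing c i j ≡ ∣ c ∣ * μ
          outgoing≡ = ∑∑-restricted c (λ i → N[ i ]of G ─ S) (λ i → ∣N[i]─S∣≡μ i ∘ c⊆T)

        arcsTouching-─-bound : arcsTouching (S ─ T) + (∣ S ∩ T ∣ * μ + ∣ S ∩ T ∣ * μ) ≤ arcsTouching S
        arcsTouching-─-bound =
          subst (_≤ arcsTouching S) lhs≡ (∑-mono-≤ (λ i → ∑-mono-≤ (touches-─-bound i)))
          where
          lhs≡ : ∑[ i < n ] ∑[ j < n ] (touches (S ─ T) i j + (outgoing (S ∩ T) i j + outgoing (S ∩ T) j i))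
               ≡ arcsTouching (S ─ T) + (∣ S ∩ T ∣ * μ + ∣ S ∩ T ∣ * μ)
          lhs≡ = trans (∑∑-distrib-+ {n} _ _)
                       (cong (arcsTouching (S ─ T) +_) (∑∑-outgoing-symmetrised (S ∩ T) (p∩q⊆q S T)))

        arcsTouching-∪-bound : arcsTouching (S ∪ T) ≤ arcsTouching S + (∣ T ─ S ∣ * μ + ∣ T ─ S ∣ * μ)
        arcsTouching-∪-bound =
          subst (arcsTouching (S ∪ T) ≤_) rhs≡ (∑-mono-≤ (λ i → ∑-mono-≤ (touches-∪-bound i)))
          where
          rhs≡ : ∑[ i < n ] ∑[ j < n ] (touches S i j + (outgoing (T ─ S) i j + outgoing (T ─ S) j i))
               ≡ arcsTouching S + (∣ T ─ S ∣ * μ + ∣ T ─ S ∣ * μ)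
          rhs≡ = trans (∑∑-distrib-+ {n} _ _)
                       (cong (arcsTouching S +_) (∑∑-outgoing-symmetrised (T ─ S) (p─q⊆p T S)))

        edgesTouching-─-bound : edgesTouching G (S ─ T) + ∣ S ∩ T ∣ * μ ≤ edgesTouching G S
        edgesTouching-─-bound = halve-≤ (begin
          (e₀ + xμ) + (e₀ + xμ)             ≡⟨ interchange e₀ xμ e₀ xμ ⟩
          (e₀ + e₀) + (xμ + xμ)             ≡⟨ cong (_+ (xμ + xμ)) (arcsTouching≡2×edgesTouching (S ─ T)) ⟨
          arcsTouching (S ─ T) + (xμ + xμ)  ≤⟨ arcsTouching-─-bound ⟩
          arcsTouching S                    ≡⟨ arcsTouching≡2×edgesTouching S ⟩
          e + e                             ∎)
          where
          open ≤-Reasoning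
          e₀ e xμ : ℕ
          e₀ = edgesTouching G (S ─ T)
          e  = edgesTouching G S
          xμ = ∣ S ∩ T ∣ * μ

        edgesTouching-∪-bound : edgesTouching G (S ∪ T) ≤ edgesTouching G S + ∣ T ─ S ∣ * μ
        edgesTouching-∪-bound = halve-≤ (begin
          e₊ + e₊                     ≡⟨ arcsTouching≡2×edgesTouching (S ∪ T) ⟨
          arcsTouching (S ∪ T)        ≤⟨ arcsTouching-∪-bound ⟩
          arcsTouching S + (yμ + yμ)  ≡⟨ cong (_+ (yμ + yμ)) (arcsTouching≡2×edgesTouching S) ⟩
          (e + e) + (yμ + yμ)         ≡⟨ interchange e e yμ yμ ⟩
          (e + yμ) + (e + yμ)         ∎)
          where
          open ≤-Reasoning
          e₊ e yμ : ℕ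
          e₊ = edgesTouching G (S ∪ T)
          e  = edgesTouching G S
          yμ = ∣ T ─ S ∣ * μ

        edge-ratio-dichotomy :
          (Σ (NonZero ∣ S ─ T ∣) λ _ → edgesTouching G (S ─ T) * ∣ S ∣ ≤ edgesTouching G S * ∣ S ─ T ∣)
          ⊎ (edgesTouching G (S ∪ T) * ∣ S ∣ ≤ edgesTouching G S * ∣ S ∪ T ∣)
        edge-ratio-dichotomy with μ * ∣ S ∣ ≤? edgesTouching G S
        ... | yes μ∣S∣≤e =
          inj₂ (subst (λ k → edgesTouching G (S ∪ T) * ∣ S ∣ ≤ edgesTouching G S * k)
                      (sym (∣p∪q∣≡∣p∣+∣q─p∣ S T))
                      (extend-average-≤ {e′ = edgesTouching G (S ∪ T)} {y = ∣ T ─ S ∣}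
                                        edgesTouching-∪-bound μ∣S∣≤e))
        ... | no μ∣S∣≰e =
          inj₁ ( shrink-average-nonempty {e′ = e₀} {x = ∣ S ∩ T ∣} edgesTouching-─-bound e<μ∣S∣
               , subst (λ k → e₀ * k ≤ edgesTouching G S * ∣ S ─ T ∣)
                       (sym (∣p∣≡∣p─q∣+∣p∩q∣ S T))
                       (shrink-average-≤ {e′ = e₀} {x = ∣ S ∩ T ∣} edgesTouching-─-bound e<μ∣S∣))
          where
          e₀ : ℕ
          e₀ = edgesTouching G (S ─ T)
          e<μ∣S∣ : edgesTouching G S < μ * (∣ S ─ T ∣ + ∣ S ∩ T ∣)
          e<μ∣S∣ = subst (λ k → edgesTouching G S < μ * k) (∣p∣≡∣p─q∣+∣p∩q∣ S T) (≰⇒> μ∣S∣≰e)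

      twins⇒common-outside-count : (∀ u v → u ∈ T → v ∈ T → N[ u ]of G ≡ N[ v ]of G) →
        ∃[ μ ] ∀ i → i ∈ T → ∣ N[ i ]of G ─ S ∣ ≡ μ
      twins⇒common-outside-count twins with nonempty? T
      ... | yes (v , v∈T) = ∣ N[ v ]of G ─ S ∣ , λ u u∈T → cong (λ N → ∣ N ─ S ∣) (twins u v u∈T v∈T)
      ... | no T-empty    = 0 , λ u u∈T → contradiction (u , u∈T) T-empty

open Counting

import Data.Integer as ℤ
open import Data.Integer using (+_; +≤+)
open import Data.Integer.Properties using (pos-*)
open import Data.Rational using (_/_; _≤_)
open import Data.Rational.Properties using (toℚᵘ-cancel-≤; toℚᵘ-fromℚᵘ)
import Data.Rational.Unnormalised as ℚᵘ
open import Data.Rational.Unnormalised.Properties using (≤-respˡ-≃; ≤-respʳ-≃; ≃-sym)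

*≤*⇒/≤/ : ∀ a b c d {{_ : NonZero b}} {{_ : NonZero d}} → a ℕ.* d ℕ.≤ c ℕ.* b → + a / b ≤ + c / d
*≤*⇒/≤/ a (suc b) c (suc d) ad≤cb = toℚᵘ-cancel-≤
  (≤-respˡ-≃ (≃-sym (toℚᵘ-fromℚᵘ (ℚᵘ.mkℚᵘ (+ a) b)))
  (≤-respʳ-≃ (≃-sym (toℚᵘ-fromℚᵘ (ℚᵘ.mkℚᵘ (+ c) d)))
  (ℚᵘ.*≤* (subst₂ ℤ._≤_ (pos-* a (suc d)) (pos-* c (suc b)) (+≤+ ad≤cb)))))

density-≤ : ∀ {n} (G : Graph n) (A B : Subset n) (nzA : NonZero ∣ A ∣) (nzB : NonZero ∣ B ∣) →
  edgesTouching G A ℕ.* ∣ B ∣ ℕ.≤ edgesTouching G B ℕ.* ∣ A ∣ → density G A nzA ≤ density G B nzB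
density-≤ G A B nzA nzB =
  *≤*⇒/≤/ (edgesTouching G A) (∣ A ∣) (edgesTouching G B) (∣ B ∣) {{nzA}} {{nzB}}

lemma4p8 : ∀ {n} (G : Graph n) (R T S : Subset n) →
    T ⊆ ∁ R →
    (∀ u v → u ∈ T → v ∈ T → N[ u ]of G ≡ N[ v ]of G) →
    S ⊆ ∁ R →
    (nzS : NonZero ∣ S ∣) →
    (Σ (NonZero ∣ S ─ T ∣) λ nz → density G (S ─ T) nz ≤ density G S nzS)
    ⊎ ((nz : NonZero ∣ S ∪ T ∣) → density G (S ∪ T) nz ≤ density G S nzS)
lemma4p8 G R T S _ twins _ nzS =
  Sum.map (map₂ (λ {nz} → density-≤ G (S ─ T) S nz nzS))
          (λ ratio nz → density-≤ G (S ∪ T) S nz nzS ratio)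
          (edge-ratio-dichotomy S T (proj₂ (twins⇒common-outside-count S T twins)))
  where open EdgeCounts G
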